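{- There is an algorithm that, given a context-free grammar $\Gamma$ generating a 0-1-symmetric language $L\subseteq\{0,1\}^*$, decides whether the graph class $\mathcal{G}_L$ has bounded treewidth (i.e., whether there is $k$ such that every graph in $\mathcal{G}_L$ has treewidth at most $k$), and likewise decides whether $\mathcal{G}_L$ has bounded degeneracy (i.e., whether there is $d$ such that every graph in $\mathcal{G}_L$ is $d$-degenerate).
   Context: All graphs are finite, simple, undirected, with nonempty vertex sets, and graph classes are considered up to isomorphism. A graph is $d$-degenerate if every subgraph has a vertex of degree at most $d$. For $w\in\{0,1\}^*$ let $\widetilde{w}$ be obtained from $w$ by exchanging the letters 0 and 1; a language $L\subseteq\{0,1\}^*$ is 0-1-symmetric if $L=\{\widetilde w : w\in L\}$. For an alphabet $V$ and distinct $u,v\in V$, $h_{u,v}:V^*\to\{0,1\}^*$ is the monoid morphism with $u\mapsto 0$, $v\mapsto 1$ and $x\mapsto\lambda$ (empty word) for all other letters $x$. For a 0-1-symmetric $L$ and a nonempty word $w$ whose set of occurring letters is $V$, $G(L,w)$ is the graph with vertex set $V$ in which distinct $u,v$ are adjacent iff $h_{u,v}(w)\in L$. A graph is $L$-representable if it is isomorphic to some $G(L,w)$, and $\mathcal{G}_L$ denotes the class of all $L$-representable graphs. -}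

module Defs where

open import Level using (0ℓ)
open import Data.Bool using (Bool; true; false; not)
open import Data.Nat using (ℕ; zero; suc; _≤_; _<_)
open import Data.Fin using (Fin; zero; suc; toℕ; _≟_)
open import Data.Fin.Subset using (Subset; _∈_; ∣_∣)
open import Data.List using (List; []; _∷_; _++_; map; length)
import Data.List.Membership.Propositional as L
open import Data.Product using (Σ; ∃; ∃-syntax; _×_; _,_)
open import Data.Sum using (_⊎_; inj₁; inj₂)
open import Function.Bundles using (_↔_; Inverse)
open import Relation.Nullary using (¬_; does)
open import Relation.Binary.PropositionalEquality using (_≡_; _≢_)

-- Languages over {0,1}; 0 is `false`, 1 is `true`.

Word : Set
Word = List Bool

Language : Set₁
Language = Word → Set

flipWord : Word → Word
flipWord = map not

ZeroOneSymmetric : Language → Set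
ZeroOneSymmetric L =
  (∀ w → L w → ∃[ v ] (L v × w ≡ flipWord v)) ×
  (∀ v → L v → L (flipWord v))

record CFG : Set where
  field
    nonterminals : ℕ
    start        : Fin nonterminals
    rules        : List (Fin nonterminals × List (Fin nonterminals ⊎ Bool))

module _ (Γ : CFG) where
  open CFG Γ

  Sym : Set
  Sym = Fin nonterminals ⊎ Bool

  data Derives : List Sym → Word → Set where
    done    : Derives [] []
    term    : ∀ {b α w} → Derives α w → Derives (inj₂ b ∷ α) (b ∷ w)
    nonterm : ∀ {A β α u v} → (A , β) L.∈ rules →
              Derives β u → Derives α v → Derives (inj₁ A ∷ α) (u ++ v)

  Lang : Language
  Lang w = Derives (inj₁ start ∷ []) w

record Graph : Set₁ where
  field
    n        : ℕ
    nonempty : 1 ≤ n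
    Adj      : Fin n → Fin n → Set
    sym      : ∀ {u v} → Adj u v → Adj v u
    irrefl   : ∀ {u} → ¬ Adj u u

Iso : (G : Graph) (m : ℕ) → (Fin m → Fin m → Set) → Set
Iso G m R = Σ (Fin n ↔ Fin m) λ f →
  ∀ u v → (Adj u v → R (Inverse.to f u) (Inverse.to f v)) ×
          (R (Inverse.to f u) (Inverse.to f v) → Adj u v)
  where open Graph G

h : ∀ {m} → Fin m → Fin m → List (Fin m) → Word
h u v [] = []
h u v (x ∷ w) with does (x ≟ u) | does (x ≟ v)
... | true  | _     = false ∷ h u v w
... | false | true  = true ∷ h u v w
... | false | false = h u v w

GAdj : Language → ∀ {m} → List (Fin m) → Fin m → Fin m → Set
GAdj L w u v = u ≢ v × L (h u v w)

Representable : Language → Graph → Set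
Representable L G =
  ∃[ m ] Σ (List (Fin m)) λ w → (∀ x → x L.∈ w) × Iso G m (GAdj L w)

data Walk {t : ℕ} (P : Fin t → Set) (R : Fin t → Fin t → Set) : Fin t → Fin t → Set where
  here : ∀ {i} → P i → Walk P R i i
  step : ∀ {i j k} → P i → R i j → Walk P R j k → Walk P R i k

-- A tree on nodes Fin (suc t) given by parent pointers: node (suc i) has parent
-- `parent i`, whose index is ≤ i (node zero is the root).  Every finite tree is
-- isomorphic to one of this form.
TreeAdj : ∀ {t} → (Fin t → Fin (suc t)) → Fin (suc t) → Fin (suc t) → Set
TreeAdj {t} parent a b =
  (∃[ i ] (a ≡ suc i × b ≡ parent i)) ⊎ (∃[ i ] (b ≡ suc i × a ≡ parent i))

record TreeDecomposition (G : Graph) (k : ℕ) : Set where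
  open Graph G
  field
    t        : ℕ
    parent   : Fin t → Fin (suc t)
    parentLt : ∀ i → toℕ (parent i) ≤ toℕ i
    bag      : Fin (suc t) → Subset n
    bagSize  : ∀ i → ∣ bag i ∣ ≤ suc k
    covV     : ∀ v → ∃[ i ] (v ∈ bag i)
    covE     : ∀ u v → Adj u v → ∃[ i ] (u ∈ bag i × v ∈ bag i)
    connected : ∀ v i j → v ∈ bag i → v ∈ bag j →
                Walk (λ x → v ∈ bag x) (TreeAdj parent) i j

TreewidthAtMost : ℕ → Graph → Set
TreewidthAtMost k G = TreeDecomposition G k

BoundedTreewidth : Language → Set₁
BoundedTreewidth L = ∃[ k ] (∀ (G : Graph) → Representable L G → TreewidthAtMost k G)

record Subgraph (G : Graph) : Set₁ where
  open Graph G
  field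
    S     : Subset n
    Sne   : ∃[ v ] (v ∈ S)
    E     : Fin n → Fin n → Set
    E⊆Adj : ∀ {u v} → E u v → Adj u v
    E⊆S   : ∀ {u v} → E u v → u ∈ S × v ∈ S
    Esym  : ∀ {u v} → E u v → E v u

DegreeAtMost : ∀ {n} → (Fin n → Fin n → Set) → Fin n → ℕ → Set
DegreeAtMost E v d = ∃[ ns ] (length ns ≤ d × (∀ u → E v u → u L.∈ ns))

Degenerate : ℕ → Graph → Set₁
Degenerate d G = ∀ (H : Subgraph G) →
  ∃[ v ] (v ∈ Subgraph.S H × DegreeAtMost (Subgraph.E H) v d)

BoundedDegeneracy : Language → Set₁
BoundedDegeneracy L = ∃[ d ] (∀ (G : Graph) → Representable L G → Degenerate d G)

-- If some word p of L contains both letters, replace every 0 of p by the list of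
-- the N "left" vertices and every 1 by the list of the N "right" vertices.  For u
-- on the left and v on the right, h_{u,v} of the resulting word w is p again, so
-- G(L,w) contains K_{N,N} and has minimum degree N.  Hence 𝒢_L has unbounded
-- degeneracy, and unbounded treewidth since graphs of treewidth k are
-- k-degenerate.  If no word of L contains both letters, then h_{u,v}(w) ∉ L
-- whenever u ≠ v both occur in w, so every graph of 𝒢_L is edgeless and has
-- treewidth 0.
--
-- Which case holds is decidable: the pair of flags "0 occurs, 1 occurs" is a
-- morphism from words to a four-element monoid, and the image of a context-free
-- language under such a morphism is read off the least fixed point of a
-- monotone operator on sets of pairs (nonterminal, monoid element).
module Submission where

open import Defs
open import Data.Bool using (Bool; true; false; not; _∨_)
open import Data.Bool.Properties using (∨-assoc) renaming (_≟_ to _≟ᵇ_)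
open import Data.Nat using (ℕ; zero; suc; _+_; _*_; _≤_; z≤n; s≤s; s≤s⁻¹)
open import Data.Nat.Properties using (module ≤-Reasoning; ≤-refl; ≤-trans; ≤-antisym; ≤-<-trans; <-irrefl; m≤n⇒m≤1+n)
open import Data.Fin using (Fin; zero; suc; toℕ; fromℕ<; _≟_; _↑ˡ_; _↑ʳ_; splitAt)
import Data.Fin.Properties as Fin
open import Data.Fin.Subset using (Subset; _∈_; _⊆_; ⊥; ⊤; ⁅_⁆; ∣_∣; inside; outside)
open import Data.Fin.Subset.Properties using (_∈?_; ∉⊥; ∈⊤; x∈⁅x⁆; x∈⁅y⁆⇒x≡y; ∣⊥∣≡0; ∣⁅x⁆∣≡1; p⊂q⇒∣p∣<∣q∣; ∣p∣≤n)
import Data.Vec as Vec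
open import Data.Vec using ([]; _∷_; here; there)
open import Data.Vec.Properties using (lookup∘tabulate; []=⇒lookup; lookup⇒[]=)
open import Data.List using (List; []; _∷_; _++_; [_]; map; concatMap; tabulate; filter; allFin; length; lookup)
open import Data.List.Properties using (++-identityʳ; length-map; filter-notAll; concatMap-cong; concatMap-pure)
open import Data.List.Membership.Propositional using (find) renaming (_∈_ to _∈ₗ_)
open import Data.List.Membership.Propositional.Properties using (∈-map⁺; ∈-filter⁺; ∈-allFin; ∈-concatMap⁺; ∈-tabulate⁺)
open import Data.List.Membership.DecPropositional _≟ᵇ_ using () renaming (_∈?_ to _∈ₗ?_)
open import Data.List.Relation.Unary.Any as Any using (Any; here; there)
open import Data.List.Relation.Unary.Any.Properties using (lookup-index)
open import Data.List.Relation.Unary.All as All using ()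
open import Data.List.Relation.Unary.All.Properties using (all-filter)
open import Data.List.Extrema.Nat using (argmin; argmax; argmin-all; argmax-all; f[argmin]≤f[xs]; f[xs]≤f[argmax])
open import Data.Product using (Σ; ∃; ∃₂; ∃-syntax; _×_; _,_; proj₁; proj₂)
open import Data.Product.Properties using (,-injectiveˡ; ,-injectiveʳ)
open import Data.Product.Function.NonDependent.Propositional using (_×-↔_)
open import Data.Sum using (_⊎_; inj₁; inj₂)
open import Function using (id; _∘_; _↔_; Inverse)
open import Function.Definitions using (Injective)
open import Function.Properties.Inverse using (↔-refl; ↔-sym)
open import Function.Construct.Composition using (_↔-∘_)
open import Relation.Nullary using (¬_; Dec; yes; no; does; ¬?; contradiction)
open import Relation.Nullary.Decidable using (map′; dec-true; _×-dec_)
open import Relation.Binary.Definitions using (DecidableEquality)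
open import Relation.Binary.PropositionalEquality using (_≡_; _≢_; refl; sym; trans; cong; cong₂; subst; module ≡-Reasoning)

-- Least fixed points on finite sets

does⇒witness : ∀ {A : Set} (a? : Dec A) → does a? ≡ true → A
does⇒witness (yes a) _  = a
does⇒witness (no _)  ()

module _ {n} {P : Fin n → Set} (P? : ∀ x → Dec (P x)) where

  ⟦_⟧ : Subset n
  ⟦_⟧ = Vec.tabulate (does ∘ P?)

  ∈⟦⟧⁺ : ∀ {x} → P x → x ∈ ⟦_⟧
  ∈⟦⟧⁺ {x} px = lookup⇒[]= x ⟦_⟧ (trans (lookup∘tabulate _ x) (dec-true (P? x) px))

  ∈⟦⟧⁻ : ∀ {x} → x ∈ ⟦_⟧ → P x
  ∈⟦⟧⁻ {x} x∈ = does⇒witness (P? x) (trans (sym (lookup∘tabulate (does ∘ P?) x)) ([]=⇒lookup x∈))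

module LeastFixedPoint {I : Set} {n : ℕ} (enum : I ↔ Fin n)
  (Step : Subset n → I → Set) (step? : ∀ S i → Dec (Step S i))
  (step-mono : ∀ {S S′} → S ⊆ S′ → ∀ {i} → Step S i → Step S′ i) where

  open Inverse enum using (to; from; strictlyInverseʳ)

  consequences : Subset n → Subset n
  consequences S = ⟦ step? S ∘ from ⟧

  ∈consequences⁺ : ∀ {S x} → Step S (from x) → x ∈ consequences S
  ∈consequences⁺ {S} = ∈⟦⟧⁺ (step? S ∘ from)

  ∈consequences⁻ : ∀ {S x} → x ∈ consequences S → Step S (from x)
  ∈consequences⁻ {S} = ∈⟦⟧⁻ (step? S ∘ from)

  consequences-mono : ∀ {S S′} → S ⊆ S′ → consequences S ⊆ consequences S′
  consequences-mono S⊆S′ x∈ = ∈consequences⁺ (step-mono S⊆S′ (∈consequences⁻ x∈))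

  iter : ℕ → Subset n
  iter zero    = ⊥
  iter (suc k) = consequences (iter k)

  iter-ascending : ∀ k → iter k ⊆ iter (suc k)
  iter-ascending zero    x∈ = contradiction x∈ ∉⊥
  iter-ascending (suc k) = consequences-mono (iter-ascending k)

  -- Until the chain stabilises, each step adds an element.
  iter-stable-or-large : ∀ k → iter (suc k) ⊆ iter k ⊎ k ≤ ∣ iter k ∣
  iter-stable-or-large zero = inj₂ z≤n
  iter-stable-or-large (suc k) with iter-stable-or-large k
  ... | inj₁ stable = inj₁ (consequences-mono stable)
  ... | inj₂ large with Fin.any? (λ x → x ∈? iter (suc k) ×-dec ¬? (x ∈? iter k))
  ...   | yes (x , new , old) = inj₂ (≤-<-trans large (p⊂q⇒∣p∣<∣q∣ (iter-ascending k , x , new , old)))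
  ...   | no none = inj₁ (consequences-mono stable)
    where
    stable : iter (suc k) ⊆ iter k
    stable {x} x∈ with x ∈? iter k
    ... | yes old = old
    ... | no ¬old = contradiction (x , x∈ , ¬old) none

  lfp : Subset n
  lfp = iter (suc n)

  lfp-closed : ∀ {i} → Step lfp i → to i ∈ lfp
  lfp-closed {i} st with iter-stable-or-large (suc n)
  ... | inj₁ stable = stable (∈consequences⁺ (subst (Step lfp) (sym (strictlyInverseʳ i)) st))
  ... | inj₂ large  = contradiction (≤-trans large (∣p∣≤n lfp)) (<-irrefl refl)

  lfp-induction : (Q : I → Set) →
                  (∀ S → (∀ {i} → to i ∈ S → Q i) → ∀ {i} → Step S i → Q i) →
                  ∀ {i} → to i ∈ lfp → Q i
  lfp-induction Q closed {i} i∈ = subst Q (strictlyInverseʳ i) (iter-sound (suc n) i∈)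
    where
    iter-sound : ∀ k {x} → x ∈ iter k → Q (from x)
    iter-sound zero    x∈ = contradiction x∈ ∉⊥
    iter-sound (suc k) x∈ =
      closed (iter k) (λ {j} j∈ → subst Q (strictlyInverseʳ j) (iter-sound k j∈)) (∈consequences⁻ x∈)

-- Images of context-free languages under finite morphisms

module _ {M : Set} {k : ℕ} (enum : M ↔ Fin k) where
  open Inverse enum using (to; from; strictlyInverseʳ)

  ≟-via-↔Fin : DecidableEquality M
  ≟-via-↔Fin x y = map′ to-injective (cong to) (to x Fin.≟ to y)
    where
    to-injective : to x ≡ to y → x ≡ y
    to-injective eq = trans (sym (strictlyInverseʳ x)) (trans (cong from eq) (strictlyInverseʳ y))

  any?-via-↔Fin : {P : M → Set} → (∀ m → Dec (P m)) → Dec (∃ P)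
  any?-via-↔Fin {P} P? = map′ (λ (i , p) → from i , p)
    (λ (m , p) → to m , subst P (sym (strictlyInverseʳ m)) p) (Fin.any? (P? ∘ from))

module HomomorphicImage (Γ : CFG) {M : Set} {k : ℕ} (enum : M ↔ Fin k)
  (_∙_ : M → M → M) (φ : Word → M) (φ-++ : ∀ u v → φ (u ++ v) ≡ φ u ∙ φ v) where

  open CFG Γ

  Item : Set
  Item = Fin nonterminals × M

  enumItem : Item ↔ Fin (nonterminals * k)
  enumItem = ↔-sym Fin.*↔× ↔-∘ (↔-refl ×-↔ enum)

  open Inverse enumItem using (to)

  _∈ᴵ_ : Item → Subset (nonterminals * k) → Set
  x ∈ᴵ S = to x ∈ S

  infix 4 _≟ₘ_
  _≟ₘ_ : DecidableEquality M
  _≟ₘ_ = ≟-via-↔Fin enum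

  -- Yields S α m: α derives a word of image m, if each nonterminal A is taken
  -- to derive words of exactly the images a with (A , a) ∈ᴵ S.
  Yields : Subset (nonterminals * k) → List (Sym Γ) → M → Set
  Yields S []           m = φ [] ≡ m
  Yields S (inj₂ b ∷ α) m = ∃[ m′ ] (Yields S α m′ × φ [ b ] ∙ m′ ≡ m)
  Yields S (inj₁ A ∷ α) m = ∃₂ λ a m′ → (A , a) ∈ᴵ S × Yields S α m′ × a ∙ m′ ≡ m

  yields? : ∀ S α m → Dec (Yields S α m)
  yields? S []           m = φ [] ≟ₘ m
  yields? S (inj₂ b ∷ α) m = any?-via-↔Fin enum λ m′ → yields? S α m′ ×-dec (φ [ b ] ∙ m′ ≟ₘ m)
  yields? S (inj₁ A ∷ α) m = any?-via-↔Fin enum λ a → any?-via-↔Fin enum λ m′ →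
    (to (A , a) ∈? S) ×-dec yields? S α m′ ×-dec (a ∙ m′ ≟ₘ m)

  yields-mono : ∀ {S S′} → S ⊆ S′ → ∀ α {m} → Yields S α m → Yields S′ α m
  yields-mono S⊆S′ []           eq                     = eq
  yields-mono S⊆S′ (inj₂ b ∷ α) (m′ , y , eq)          = m′ , yields-mono S⊆S′ α y , eq
  yields-mono S⊆S′ (inj₁ A ∷ α) (a , m′ , A∈ , y , eq) = a , m′ , S⊆S′ A∈ , yields-mono S⊆S′ α y , eq

  Step : Subset (nonterminals * k) → Item → Set
  Step S (A , m) = Any (λ (B , β) → B ≡ A × Yields S β m) rules

  step? : ∀ S x → Dec (Step S x)
  step? S (A , m) = Any.any? (λ (B , β) → (B Fin.≟ A) ×-dec yields? S β m) rules

  step-mono : ∀ {S S′} → S ⊆ S′ → ∀ {x} → Step S x → Step S′ x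
  step-mono S⊆S′ = Any.map λ (eq , y) → eq , yields-mono S⊆S′ _ y

  open LeastFixedPoint enumItem Step step? step-mono using (lfp; lfp-closed; lfp-induction)

  rule-step : ∀ {S A β m} → (A , β) ∈ₗ rules → Yields S β m → Step S (A , m)
  rule-step A→β y = Any.map (λ { refl → refl , y }) A→β

  DerivableImage : Item → Set
  DerivableImage (A , m) = ∃₂ λ β w → (A , β) ∈ₗ rules × Derives Γ β w × φ w ≡ m

  yields-sound : ∀ {S} → (∀ {x} → x ∈ᴵ S → DerivableImage x) →
                 ∀ α {m} → Yields S α m → ∃[ w ] (Derives Γ α w × φ w ≡ m)
  yields-sound S-sound [] φ[]≡m = [] , done , φ[]≡m
  yields-sound S-sound (inj₂ b ∷ α) (m′ , y , eq) with yields-sound S-sound α y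
  ... | w , d , refl = b ∷ w , term d , trans (φ-++ [ b ] w) eq
  yields-sound S-sound (inj₁ A ∷ α) (a , m′ , A∈ , y , eq)
    with S-sound A∈ | yields-sound S-sound α y
  ... | β , u , A→β , dβ , refl | v , dα , refl = u ++ v , nonterm A→β dβ dα , trans (φ-++ u v) eq

  step⇒rule : ∀ {S A m} → Step S (A , m) → ∃[ β ] ((A , β) ∈ₗ rules × Yields S β m)
  step⇒rule st with find st
  ... | (_ , β) , A→β , refl , y = β , A→β , y

  lfp-sound : ∀ {x} → x ∈ᴵ lfp → DerivableImage x
  lfp-sound = lfp-induction DerivableImage λ S S-sound st →
    let β , A→β , y = step⇒rule st
        w , d , eq = yields-sound S-sound β y
    in β , w , A→β , d , eq

  derives-yields : ∀ {α w} → Derives Γ α w → Yields lfp α (φ w)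
  derives-yields done                 = refl
  derives-yields (term {b} {w = w} d) = φ w , derives-yields d , sym (φ-++ [ b ] w)
  derives-yields (nonterm {u = u} {v} A→β dβ dα) =
    φ u , φ v , lfp-closed (rule-step A→β (derives-yields dβ)) , derives-yields dα , sym (φ-++ u v)

  lang⇒∈lfp : ∀ {w} → Lang Γ w → (start , φ w) ∈ᴵ lfp
  lang⇒∈lfp (nonterm {u = u} A→β d done) =
    subst (λ w → (start , φ w) ∈ᴵ lfp) (sym (++-identityʳ u))
          (lfp-closed (rule-step A→β (derives-yields d)))

  image? : ∀ m → Dec (∃[ w ] (Lang Γ w × φ w ≡ m))
  image? m with to (start , m) ∈? lfp
  ... | yes ∈lfp = let β , w , A→β , d , eq = lfp-sound ∈lfp in
    yes (w ++ [] , nonterm A→β d done , trans (cong φ (++-identityʳ w)) eq)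
  ... | no ∉lfp = no λ { (w , d , refl) → ∉lfp (lang⇒∈lfp d) }

HasBoth : Word → Set
HasBoth w = false ∈ₗ w × true ∈ₗ w

occurs : Bool → Word → Bool
occurs b w = does (b ∈ₗ? w)

occurs-++ : ∀ b u v → occurs b (u ++ v) ≡ occurs b u ∨ occurs b v
occurs-++ b []      v = refl
occurs-++ b (c ∷ u) v =
  trans (cong (does (b ≟ᵇ c) ∨_) (occurs-++ b u v)) (sym (∨-assoc (does (b ≟ᵇ c)) _ _))

_∨²_ : Bool × Bool → Bool × Bool → Bool × Bool
(a , b) ∨² (c , d) = a ∨ c , b ∨ d

letters : Word → Bool × Bool
letters w = occurs false w , occurs true w

letters-++ : ∀ u v → letters (u ++ v) ≡ letters u ∨² letters v
letters-++ u v = cong₂ _,_ (occurs-++ false u v) (occurs-++ true u v)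

occurs⇒∈ : ∀ {b w} → occurs b w ≡ true → b ∈ₗ w
occurs⇒∈ {b} {w} = does⇒witness (b ∈ₗ? w)

hasBoth⇒letters : ∀ {w} → HasBoth w → letters w ≡ (true , true)
hasBoth⇒letters (f∈ , t∈) = cong₂ _,_ (dec-true (false ∈ₗ? _) f∈) (dec-true (true ∈ₗ? _) t∈)

letters⇒hasBoth : ∀ {w} → letters w ≡ (true , true) → HasBoth w
letters⇒hasBoth eq = occurs⇒∈ (,-injectiveˡ eq) , occurs⇒∈ (,-injectiveʳ eq)

Bool²↔Fin4 : (Bool × Bool) ↔ Fin 4
Bool²↔Fin4 = ↔-sym ((Fin.2↔Bool ×-↔ Fin.2↔Bool) ↔-∘ Fin.*↔×)

hasBoth? : (Γ : CFG) → Dec (∃[ w ] (Lang Γ w × HasBoth w))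
hasBoth? Γ = map′ (λ (w , w∈L , eq) → w , w∈L , letters⇒hasBoth eq)
                  (λ (w , w∈L , both) → w , w∈L , hasBoth⇒letters both)
                  (image? (true , true))
  where open HomomorphicImage Γ Bool²↔Fin4 _∨²_ letters letters-++

module _ {m} {u v : Fin m} where

  h-++ : ∀ xs ys → h u v (xs ++ ys) ≡ h u v xs ++ h u v ys
  h-++ []       ys = refl
  h-++ (x ∷ xs) ys with does (x ≟ u) | does (x ≟ v)
  ... | true  | _     = cong (false ∷_) (h-++ xs ys)
  ... | false | true  = cong (true ∷_) (h-++ xs ys)
  ... | false | false = h-++ xs ys

  h-concatMap : ∀ {A : Set} (f : A → List (Fin m)) xs →
                h u v (concatMap f xs) ≡ concatMap (h u v ∘ f) xs
  h-concatMap f []       = refl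
  h-concatMap f (x ∷ xs) = trans (h-++ (f x) (concatMap f xs)) (cong (h u v (f x) ++_) (h-concatMap f xs))

  h-head : ∀ w → h u v (u ∷ w) ≡ false ∷ h u v w
  h-head w with u ≟ u
  ... | yes _   = refl
  ... | no u≢u = contradiction refl u≢u

  h-skip : ∀ {x} w → x ≢ u → x ≢ v → h u v (x ∷ w) ≡ h u v w
  h-skip {x} w x≢u x≢v with x ≟ u | x ≟ v
  ... | yes x≡u | _       = contradiction x≡u x≢u
  ... | no _    | yes x≡v = contradiction x≡v x≢v
  ... | no _    | no _    = refl

  h-swap : u ≢ v → ∀ w → h v u w ≡ flipWord (h u v w)
  h-swap u≢v []      = refl
  h-swap u≢v (x ∷ w) with x ≟ u | x ≟ v
  ... | yes refl | yes refl = contradiction refl u≢v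
  ... | yes refl | no _     = cong (true ∷_) (h-swap u≢v w)
  ... | no _     | yes refl = cong (false ∷_) (h-swap u≢v w)
  ... | no _     | no _     = h-swap u≢v w

  false∈h : ∀ {w} → u ∈ₗ w → false ∈ₗ h u v w
  false∈h {x ∷ w} (here refl) = subst (false ∈ₗ_) (sym (h-head w)) (here refl)
  false∈h {x ∷ w} (there u∈w) with does (x ≟ u) | does (x ≟ v)
  ... | true  | _     = there (false∈h u∈w)
  ... | false | true  = there (false∈h u∈w)
  ... | false | false = false∈h u∈w

hasBoth-h : ∀ {m} {u v : Fin m} {w} → u ≢ v → u ∈ₗ w → v ∈ₗ w → HasBoth (h u v w)
hasBoth-h {w = w} u≢v u∈w v∈w =
  false∈h u∈w , subst (true ∈ₗ_) (sym (h-swap (u≢v ∘ sym) w)) (∈-map⁺ not (false∈h v∈w))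

h-tabulate-absent : ∀ {m K} {u v : Fin m} (f : Fin K → Fin m) → (∀ i → f i ≢ u) → (∀ i → f i ≢ v) →
                    h u v (tabulate f) ≡ []
h-tabulate-absent {K = zero}  f f≢u f≢v = refl
h-tabulate-absent {K = suc K} f f≢u f≢v =
  trans (h-skip (tabulate (f ∘ suc)) (f≢u zero) (f≢v zero))
        (h-tabulate-absent (f ∘ suc) (f≢u ∘ suc) (f≢v ∘ suc))

h-tabulate-once : ∀ {m K} {v : Fin m} (f : Fin K → Fin m) → Injective _≡_ _≡_ f → (∀ i → f i ≢ v) →
                  ∀ i → h (f i) v (tabulate f) ≡ [ false ]
h-tabulate-once f f-inj f≢v zero =
  trans (h-head (tabulate (f ∘ suc)))
        (cong (false ∷_) (h-tabulate-absent (f ∘ suc) (λ i eq → contradiction (f-inj eq) λ ()) (f≢v ∘ suc)))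
h-tabulate-once f f-inj f≢v (suc i) =
  trans (h-skip (tabulate (f ∘ suc)) (λ eq → contradiction (f-inj eq) λ ()) (f≢v zero))
        (h-tabulate-once (f ∘ suc) (λ eq → Fin.suc-injective (f-inj eq)) (f≢v ∘ suc) i)

FlipClosed : Language → Set
FlipClosed L = ∀ w → L w → L (flipWord w)

wordGraph : (L : Language) → FlipClosed L → ∀ {m} → 1 ≤ m → List (Fin m) → Graph
wordGraph L L-flip {m} m≥1 w = record
  { n        = m
  ; nonempty = m≥1
  ; Adj      = GAdj L w
  ; sym      = λ (u≢v , uv∈L) → u≢v ∘ sym , subst L (sym (h-swap u≢v w)) (L-flip _ uv∈L)
  ; irrefl   = λ (u≢u , _) → u≢u refl
  }

wordGraph-representable : ∀ {L} L-flip {m} (m≥1 : 1 ≤ m) {w : List (Fin m)} →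
                          (∀ x → x ∈ₗ w) → Representable L (wordGraph L L-flip m≥1 w)
wordGraph-representable _ _ {w} complete = _ , w , complete , ↔-refl , λ _ _ → id , id

representable-edgeless : ∀ {L} → ¬ (∃[ w ] (L w × HasBoth w)) →
                         ∀ {G} → Representable L G → ∀ {u v} → ¬ Graph.Adj G u v
representable-edgeless noBoth (_ , _ , complete , _ , iso) {u} {v} uv =
  let fu≢fv , h∈L = proj₁ (iso u v) uv
  in noBoth (_ , h∈L , hasBoth-h fu≢fv (complete _) (complete _))

edgeless-treewidth0 : ∀ G → (∀ {u v} → ¬ Graph.Adj G u v) → TreewidthAtMost 0 G
edgeless-treewidth0 G edgeless = record
  { t         = n
  ; parent    = λ _ → zero
  ; parentLt  = λ _ → z≤n
  ; bag       = bag
  ; bagSize   = bagSize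
  ; covV      = λ v → suc v , x∈⁅x⁆ v
  ; covE      = λ _ _ uv → contradiction uv edgeless
  ; connected = connected
  }
  where
  open Graph G using (n)

  bag : Fin (suc n) → Subset n
  bag zero    = ⊥
  bag (suc v) = ⁅ v ⁆

  bagSize : ∀ i → ∣ bag i ∣ ≤ 1
  bagSize zero    = subst (_≤ 1) (sym (∣⊥∣≡0 n)) z≤n
  bagSize (suc v) = subst (_≤ 1) (sym (∣⁅x⁆∣≡1 v)) ≤-refl

  connected : ∀ v i j → v ∈ bag i → v ∈ bag j → Walk (λ x → v ∈ bag x) (TreeAdj (λ _ → zero)) i j
  connected v zero    _       v∈ _  = contradiction v∈ ∉⊥
  connected v (suc i) zero    _  v∈ = contradiction v∈ ∉⊥
  connected v (suc i) (suc j) v∈i v∈j with x∈⁅y⁆⇒x≡y i v∈i | x∈⁅y⁆⇒x≡y j v∈j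
  ... | refl | refl = here v∈i

-- Treewidth and degeneracy

elements : ∀ {n} → Subset n → List (Fin n)
elements []            = []
elements (inside  ∷ p) = zero ∷ map suc (elements p)
elements (outside ∷ p) = map suc (elements p)

length-elements : ∀ {n} (p : Subset n) → length (elements p) ≡ ∣ p ∣
length-elements []            = refl
length-elements (inside  ∷ p) = cong suc (trans (length-map suc (elements p)) (length-elements p))
length-elements (outside ∷ p) = trans (length-map suc (elements p)) (length-elements p)

∈-elements : ∀ {n} {p : Subset n} {x} → x ∈ p → x ∈ₗ elements p
∈-elements {p = inside  ∷ p} here        = here refl
∈-elements {p = inside  ∷ p} (there x∈p) = there (∈-map⁺ suc (∈-elements x∈p))
∈-elements {p = outside ∷ p} (there x∈p) = ∈-map⁺ suc (∈-elements x∈p)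

injective⇒≤length : ∀ {A : Set} {m} {xs : List A} (f : Fin m → A) → Injective _≡_ _≡_ f →
                    (∀ i → f i ∈ₗ xs) → m ≤ length xs
injective⇒≤length {xs = xs} f f-inj f∈xs = Fin.injective⇒≤ index-injective
  where
  index-injective : Injective _≡_ _≡_ (Any.index ∘ f∈xs)
  index-injective {i} {j} eq = f-inj (trans (lookup-index (f∈xs i))
                                     (trans (cong (lookup xs) eq) (sym (lookup-index (f∈xs j)))))

module _ {n} {P : Fin n → Set} (P? : ∀ x → Dec (P x)) (f : Fin n → ℕ) where

  private
    candidates : List (Fin n)
    candidates = filter P? (allFin n)

    ∈-candidates : ∀ {x} → P x → x ∈ₗ candidates
    ∈-candidates px = ∈-filter⁺ P? (∈-allFin _) px

  argmin-satisfying : ∃ P → Σ (Fin n) λ x → P x × ∀ y → P y → f x ≤ f y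
  argmin-satisfying (x₀ , px₀) =
    argmin f x₀ candidates ,
    argmin-all f px₀ (all-filter P? (allFin n)) ,
    λ y py → All.lookup (f[argmin]≤f[xs] x₀ candidates) (∈-candidates py)

  argmax-satisfying : ∃ P → Σ (Fin n) λ x → P x × ∀ y → P y → f y ≤ f x
  argmax-satisfying (x₀ , px₀) =
    argmax f x₀ candidates ,
    argmax-all f px₀ (all-filter P? (allFin n)) ,
    λ y py → All.lookup (f[xs]≤f[argmax] x₀ candidates) (∈-candidates py)

module _ {G : Graph} {k : ℕ} (td : TreeDecomposition G k) where
  open Graph G using (n; Adj)
  open TreeDecomposition td

  data Descendant (r : Fin (suc t)) : Fin (suc t) → Set where
    self  : Descendant r r
    child : ∀ {i} → Descendant r (parent i) → Descendant r (suc i)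

  descendant⇒≥ : ∀ {r x} → Descendant r x → toℕ r ≤ toℕ x
  descendant⇒≥ self              = ≤-refl
  descendant⇒≥ (child {i} r≼pi) = ≤-trans (descendant⇒≥ r≼pi) (m≤n⇒m≤1+n (parentLt i))

  walk-leaves-subtree : ∀ {P i j r} → Walk P (TreeAdj parent) i j → Descendant r i → P r ⊎ Descendant r j
  walk-leaves-subtree (here _)                              r≼i         = inj₂ r≼i
  walk-leaves-subtree (step P-r (inj₁ (_ , refl , refl)) _) self        = inj₁ P-r
  walk-leaves-subtree (step _   (inj₁ (_ , refl , refl)) w) (child r≼i) = walk-leaves-subtree w r≼i
  walk-leaves-subtree (step _   (inj₂ (_ , refl , refl)) w) r≼i         = walk-leaves-subtree w (child r≼i)

  walk-to-least : ∀ {P x r} → Walk P (TreeAdj parent) x r → (∀ z → P z → toℕ r ≤ toℕ z) → Descendant r x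
  walk-to-least (here _) least = self
  walk-to-least (step _ (inj₁ (_ , refl , refl)) w) least = child (walk-to-least w least)
  walk-to-least (step P-x (inj₂ (i , refl , refl)) w) least with walk-to-least w least
  ... | self      = contradiction (≤-trans (least _ P-x) (parentLt i)) (<-irrefl refl)
  ... | child r≼x = r≼x

  -- The nodes whose bags contain v form a subtree; as parents have smaller
  -- indices than their children, its least node top v is its root.
  private
    least-bag : ∀ v → Σ (Fin (suc t)) λ i → v ∈ bag i × ∀ z → v ∈ bag z → toℕ i ≤ toℕ z
    least-bag v = argmin-satisfying (λ i → v ∈? bag i) toℕ (covV v)

  top : Fin n → Fin (suc t)
  top v = proj₁ (least-bag v)

  ∈-bag-top : ∀ v → v ∈ bag (top v)
  ∈-bag-top v = proj₁ (proj₂ (least-bag v))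

  top-least : ∀ v z → v ∈ bag z → toℕ (top v) ≤ toℕ z
  top-least v = proj₂ (proj₂ (least-bag v))

  -- A bag containing u and v lies below top v.  The walk from it to top u
  -- through u's bags either meets top v, or ends below it, forcing top u = top v.
  neighbour-∈-bag-top : ∀ {u v} → Adj v u → toℕ (top u) ≤ toℕ (top v) → u ∈ bag (top v)
  neighbour-∈-bag-top {u} {v} vu top-u≤top-v with covE v u vu
  ... | j , v∈j , u∈j
    with walk-leaves-subtree (connected u j (top u) u∈j (∈-bag-top u))
           (walk-to-least (connected v j (top v) v∈j (∈-bag-top v)) (top-least v))
  ... | inj₁ u∈top-v = u∈top-v
  ... | inj₂ top-v≼top-u = subst (λ r → u ∈ bag r) top-u≡top-v (∈-bag-top u)
    where
    top-u≡top-v : top u ≡ top v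
    top-u≡top-v = Fin.toℕ-injective (≤-antisym top-u≤top-v (descendant⇒≥ top-v≼top-u))

-- The vertex v of H whose top bag is deepest has all its H-neighbours in that
-- bag, which has at most k + 1 elements, v among them.
treewidth⇒degenerate : ∀ {G k} → TreewidthAtMost k G → Degenerate k G
treewidth⇒degenerate {G} {k} td H = v , v∈S , neighbours , length-neighbours , ∈-neighbours
  where
  open Graph G using (n; irrefl)
  open Subgraph H
  open TreeDecomposition td using (bag; bagSize)

  deepest : Σ (Fin n) λ v → v ∈ S × ∀ u → u ∈ S → toℕ (top td u) ≤ toℕ (top td v)
  deepest = argmax-satisfying (_∈? S) (toℕ ∘ top td) Sne

  v : Fin n
  v = proj₁ deepest

  v∈S : v ∈ S
  v∈S = proj₁ (proj₂ deepest)

  ≢v? : ∀ u → Dec (u ≢ v)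
  ≢v? u = ¬? (u Fin.≟ v)

  neighbours : List (Fin n)
  neighbours = filter ≢v? (elements (bag (top td v)))

  length-neighbours : length neighbours ≤ k
  length-neighbours = s≤s⁻¹ (begin-strict
    length neighbours                    <⟨ filter-notAll ≢v? _ v-listed ⟩
    length (elements (bag (top td v)))   ≡⟨ length-elements (bag (top td v)) ⟩
    ∣ bag (top td v) ∣                   ≤⟨ bagSize _ ⟩
    suc k                                ∎)
    where
    open ≤-Reasoning
    v-listed : Any (λ u → ¬ u ≢ v) (elements (bag (top td v)))
    v-listed = Any.map (λ v≡u u≢v → u≢v (sym v≡u)) (∈-elements (∈-bag-top td v))

  ∈-neighbours : ∀ u → E v u → u ∈ₗ neighbours
  ∈-neighbours u vu = ∈-filter⁺ ≢v? (∈-elements u∈top-v) u≢v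
    where
    u∈top-v : u ∈ bag (top td v)
    u∈top-v = neighbour-∈-bag-top td (E⊆Adj vu) (proj₂ (proj₂ deepest) u (proj₂ (E⊆S vu)))
    u≢v : u ≢ v
    u≢v refl = irrefl (E⊆Adj vu)

MinDegreeAtLeast : ℕ → Graph → Set
MinDegreeAtLeast N G = ∀ v → Σ (Fin N → Fin n) λ g → Injective _≡_ _≡_ g × ∀ j → Adj v (g j)
  where open Graph G

minDegree⇒¬degenerate : ∀ {d G} → MinDegreeAtLeast (suc d) G → ¬ Degenerate d G
minDegree⇒¬degenerate {G = G} minDegree degenerate =
  let v , _ , ns , length≤d , ∈ns = degenerate wholeGraph
      g , g-injective , v~g = minDegree v
  in <-irrefl refl (≤-trans (injective⇒≤length g g-injective (λ j → ∈ns (g j) (v~g j))) length≤d)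
  where
  open Graph G using (Adj; nonempty) renaming (sym to Adj-sym)
  wholeGraph : Subgraph G
  wholeGraph = record
    { S = ⊤ ; Sne = fromℕ< nonempty , ∈⊤ ; E = Adj ; E⊆Adj = id ; E⊆S = λ _ → ∈⊤ , ∈⊤ ; Esym = Adj-sym }

-- Complete bipartite graphs in 𝒢_L

module CompleteBipartite (N : ℕ) where

  left right : Fin N → Fin (N + N)
  left  i = i ↑ˡ N
  right j = N ↑ʳ j

  left≢right : ∀ i j → left i ≢ right j
  left≢right i j eq = contradiction splits λ ()
    where
    open ≡-Reasoning
    splits : inj₁ i ≡ inj₂ j
    splits = begin
      inj₁ i              ≡⟨ Fin.splitAt-↑ˡ N i N ⟨
      splitAt N (left i)  ≡⟨ cong (splitAt N) eq ⟩
      splitAt N (right j) ≡⟨ Fin.splitAt-↑ʳ N N j ⟩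
      inj₂ j              ∎

  left-or-right : ∀ x → (∃[ i ] (left i ≡ x)) ⊎ (∃[ j ] (right j ≡ x))
  left-or-right x with splitAt N x in eq
  ... | inj₁ i = inj₁ (i , Fin.splitAt⁻¹-↑ˡ eq)
  ... | inj₂ j = inj₂ (j , Fin.splitAt⁻¹-↑ʳ eq)

  block : Bool → List (Fin (N + N))
  block false = tabulate left
  block true  = tabulate right

  bipartiteWord : Word → List (Fin (N + N))
  bipartiteWord = concatMap block

  h-block : ∀ i j b → h (left i) (right j) (block b) ≡ [ b ]
  h-block i j false = h-tabulate-once left (Fin.↑ˡ-injective N _ _) (λ i′ → left≢right i′ j) i
  h-block i j true  = begin
    h (left i) (right j) (tabulate right)            ≡⟨ h-swap (left≢right i j ∘ sym) (tabulate right) ⟩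
    flipWord (h (right j) (left i) (tabulate right)) ≡⟨ cong flipWord h-right ⟩
    [ true ]                                         ∎
    where
    open ≡-Reasoning
    h-right : h (right j) (left i) (tabulate right) ≡ [ false ]
    h-right = h-tabulate-once right (Fin.↑ʳ-injective N _ _) (λ j′ eq → left≢right i j′ (sym eq)) j

  h-bipartiteWord : ∀ i j p → h (left i) (right j) (bipartiteWord p) ≡ p
  h-bipartiteWord i j p = begin
    h (left i) (right j) (concatMap block p)        ≡⟨ h-concatMap block p ⟩
    concatMap (h (left i) (right j) ∘ block) p      ≡⟨ concatMap-cong (h-block i j) p ⟩
    concatMap [_] p                                 ≡⟨ concatMap-pure p ⟩
    p                                               ∎
    where open ≡-Reasoning

  module _ {L : Language} (L-flip : FlipClosed L) {p : Word} (p∈L : L p) (p-both : HasBoth p) where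

    bipartiteWord-complete : ∀ x → x ∈ₗ bipartiteWord p
    bipartiteWord-complete x with left-or-right x
    ... | inj₁ (i , refl) = ∈-concatMap⁺ block (Any.map (λ { refl → ∈-tabulate⁺ i }) (proj₁ p-both))
    ... | inj₂ (j , refl) = ∈-concatMap⁺ block (Any.map (λ { refl → ∈-tabulate⁺ j }) (proj₂ p-both))

    left~right : ∀ i j → GAdj L (bipartiteWord p) (left i) (right j)
    left~right i j = left≢right i j , subst L (sym (h-bipartiteWord i j p)) p∈L

bipartite-minDegree : ∀ {L} → FlipClosed L → ∀ {p} → L p → HasBoth p →
                      ∀ N → Σ Graph λ G → Representable L G × MinDegreeAtLeast (suc N) G
bipartite-minDegree {L} L-flip {p} p∈L p-both N =
  G , wordGraph-representable L-flip (s≤s z≤n) (bipartiteWord-complete L-flip p∈L p-both) , minDegree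
  where
  open CompleteBipartite (suc N)
  G : Graph
  G = wordGraph L L-flip (s≤s z≤n) (bipartiteWord p)
  minDegree : MinDegreeAtLeast (suc N) G
  minDegree v with left-or-right v
  ... | inj₁ (i , refl) = right , Fin.↑ʳ-injective (suc N) _ _ , left~right L-flip p∈L p-both i
  ... | inj₂ (j , refl) = left , Fin.↑ˡ-injective (suc N) _ _ , λ i → Graph.sym G (left~right L-flip p∈L p-both i j)

boundedTreewidth⇒boundedDegeneracy : ∀ L → BoundedTreewidth L → BoundedDegeneracy L
boundedTreewidth⇒boundedDegeneracy L (k , tw≤k) = k , λ G G∈𝒢 → treewidth⇒degenerate (tw≤k G G∈𝒢)

hasBoth⇒¬boundedDegeneracy : ∀ {L p} → FlipClosed L → L p → HasBoth p → ¬ BoundedDegeneracy L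
hasBoth⇒¬boundedDegeneracy L-flip p∈L p-both (d , degenerate) =
  let G , G∈𝒢 , minDegree = bipartite-minDegree L-flip p∈L p-both d
  in minDegree⇒¬degenerate minDegree (degenerate G G∈𝒢)

¬hasBoth⇒boundedTreewidth : ∀ {L} → ¬ (∃[ w ] (L w × HasBoth w)) → BoundedTreewidth L
¬hasBoth⇒boundedTreewidth {L} noBoth =
  0 , λ G G∈𝒢 → edgeless-treewidth0 G (representable-edgeless {L} noBoth {G} G∈𝒢)

mainTheorem7 : (Γ : CFG) → ZeroOneSymmetric (Lang Γ) →
               Dec (BoundedTreewidth (Lang Γ)) × Dec (BoundedDegeneracy (Lang Γ))
mainTheorem7 Γ (_ , L-flip) with hasBoth? Γ
... | yes (p , p∈L , p-both) =
  no (unbounded ∘ boundedTreewidth⇒boundedDegeneracy (Lang Γ)) , no unbounded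
  where
  unbounded : ¬ BoundedDegeneracy (Lang Γ)
  unbounded = hasBoth⇒¬boundedDegeneracy L-flip p∈L p-both
... | no noBoth =
  yes bounded , yes (boundedTreewidth⇒boundedDegeneracy (Lang Γ) bounded)
  where
  bounded : BoundedTreewidth (Lang Γ)
  bounded = ¬hasBoth⇒boundedTreewidth noBoth
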